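{- For all terms $t, t'$ and every substitution $\theta$: if $t \approx t'$ then $t\langle\theta\rangle \approx t'\langle\theta\rangle$ (for any admissible choices of the renaming permutations used in forming $t\langle\theta\rangle$ and $t'\langle\theta\rangle$).
   Context: Terms are simply typed $\lambda$-terms, identified up to $\alpha\beta\eta$-conversion. The constants are partitioned into a set $\mathcal{C}$ of nominal constants (infinitely many of each relevant type) and a set $\mathcal{K}$ of other constants. The support $\mathrm{supp}(t)$ of a term is the set of nominal constants occurring in it. A permutation is a type-preserving bijection $\pi:\mathcal{C}\to\mathcal{C}$ with $\{x \mid \pi(x)\neq x\}$ finite, applied to terms by $\pi.a=\pi(a)$ for $a\in\mathcal{C}$, $\pi.c=c$ for other atoms, $\pi.(\lambda x.M)=\lambda x.(\pi.M)$, $\pi.(M\ N)=(\pi.M)\ (\pi.N)$. We write $B\approx B'$ if there is a permutation $\pi$ such that $B$ $\lambda$-converts to $\pi.B'$. A substitution is a type-preserving map from variables to terms that is the identity on all but finitely many variables; $\mathrm{supp}(\theta)$ is the set of nominal constants in its range. $B[\theta]$ denotes ordinary capture-avoiding substitution. The nominal capture-avoiding application $B\langle\theta\rangle$ is defined as $(\pi.B)[\theta]$, where $\pi$ is any permutation mapping the nominal constants of $\mathrm{supp}(B)$ to nominal constants not in $\mathrm{supp}(\theta)$. -}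

module Defs where

open import Data.Nat using (ℕ)
open import Data.List using (List; []; _∷_)
open import Data.List.Membership.Propositional using (_∈_)
open import Data.Product using (Σ; ∃; _,_; _×_)
open import Relation.Nullary using (¬_)
open import Relation.Binary.PropositionalEquality using (_≡_; _≢_)

infixr 7 _⇒_
data Ty : Set where
  ι   : ℕ → Ty
  _⇒_ : Ty → Ty → Ty

Ctx : Set
Ctx = List Ty

data _∋_ : Ctx → Ty → Set where
  here  : ∀ {Γ A} → (A ∷ Γ) ∋ A
  there : ∀ {Γ A B} → Γ ∋ A → (B ∷ Γ) ∋ A

-- Terms over a signature K of (non-nominal) constants, K A = constants of
-- type A.  Nominal constants of type A are  nom n  for n : ℕ
-- (infinitely many for every type).  Variables are de Bruijn indices
-- (so α-equivalence is syntactic equality); the free variables of a term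
-- in  Tm K Γ A  are those of Γ.

module _ (K : Ty → Set) where

  data Tm (Γ : Ctx) : Ty → Set where
    var : ∀ {A} → Γ ∋ A → Tm Γ A
    nom : ∀ {A} → ℕ → Tm Γ A
    con : ∀ {A} → K A → Tm Γ A
    lam : ∀ {A B} → Tm (A ∷ Γ) B → Tm Γ (A ⇒ B)
    app : ∀ {A B} → Tm Γ (A ⇒ B) → Tm Γ A → Tm Γ B

module _ {K : Ty → Set} where

  Ren : Ctx → Ctx → Set
  Ren Γ Δ = ∀ {A} → Γ ∋ A → Δ ∋ A

  ext : ∀ {Γ Δ B} → Ren Γ Δ → Ren (B ∷ Γ) (B ∷ Δ)
  ext ρ here      = here
  ext ρ (there x) = there (ρ x)

  ren : ∀ {Γ Δ A} → Ren Γ Δ → Tm K Γ A → Tm K Δ A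
  ren ρ (var x)   = var (ρ x)
  ren ρ (nom n)   = nom n
  ren ρ (con c)   = con c
  ren ρ (lam t)   = lam (ren (ext ρ) t)
  ren ρ (app t u) = app (ren ρ t) (ren ρ u)

  -- A substitution for the free variables Γ, with result terms over Δ
  -- (variables not "really" substituted are mapped to variables, so it is
  -- the identity on all but finitely many variables).
  Sub : Ctx → Ctx → Set
  Sub Γ Δ = ∀ {A} → Γ ∋ A → Tm K Δ A

  exts : ∀ {Γ Δ B} → Sub Γ Δ → Sub (B ∷ Γ) (B ∷ Δ)
  exts σ here      = var here
  exts σ (there x) = ren there (σ x)

  sub : ∀ {Γ Δ A} → Sub Γ Δ → Tm K Γ A → Tm K Δ A
  sub σ (var x)   = σ x
  sub σ (nom n)   = nom n
  sub σ (con c)   = con c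
  sub σ (lam t)   = lam (sub (exts σ) t)
  sub σ (app t u) = app (sub σ t) (sub σ u)

  single : ∀ {Γ A} → Tm K Γ A → Sub (A ∷ Γ) Γ
  single u here      = u
  single u (there x) = var x

  infix 4 _≡βη_
  data _≡βη_ {Γ : Ctx} : ∀ {A} → Tm K Γ A → Tm K Γ A → Set where
    β     : ∀ {A B} (t : Tm K (A ∷ Γ) B) (u : Tm K Γ A) →
            app (lam t) u ≡βη sub (single u) t
    η     : ∀ {A B} (t : Tm K Γ (A ⇒ B)) →
            lam (app (ren there t) (var here)) ≡βη t
    refl  : ∀ {A} {t : Tm K Γ A} → t ≡βη t
    sym   : ∀ {A} {t u : Tm K Γ A} → t ≡βη u → u ≡βη t
    trans : ∀ {A} {t u v : Tm K Γ A} → t ≡βη u → u ≡βη v → t ≡βη v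
    lam-cong : ∀ {A B} {t t' : Tm K (A ∷ Γ) B} → t ≡βη t' → lam t ≡βη lam t'
    app-cong : ∀ {A B} {t t' : Tm K Γ (A ⇒ B)} {u u' : Tm K Γ A} →
               t ≡βη t' → u ≡βη u' → app t u ≡βη app t' u'

  data Occurs (A : Ty) (n : ℕ) {Γ : Ctx} : ∀ {B} → Tm K Γ B → Set where
    occ-nom  : Occurs A n (nom {A = A} n)
    occ-lam  : ∀ {B C} {t : Tm K (B ∷ Γ) C} → Occurs A n t → Occurs A n (lam t)
    occ-appl : ∀ {B C} {t : Tm K Γ (B ⇒ C)} {u : Tm K Γ B} →
               Occurs A n t → Occurs A n (app t u)
    occ-appr : ∀ {B C} {t : Tm K Γ (B ⇒ C)} {u : Tm K Γ B} →
               Occurs A n u → Occurs A n (app t u)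

  -- supp(t): since terms are identified up to λ-conversion, the support
  -- is taken of the equivalence class: the nominal constants occurring in
  -- every representative (= those of the βη-normal form).
  Supp : ∀ {Γ B} → Tm K Γ B → (A : Ty) → ℕ → Set
  Supp t A n = ∀ t' → t ≡βη t' → Occurs A n t'

  SuppSub : ∀ {Γ Δ} → Sub Γ Δ → (A : Ty) → ℕ → Set
  SuppSub {Γ} θ A n = Σ Ty λ B → Σ (Γ ∋ B) λ x → Supp (θ x) A n

record Perm : Set where
  field
    fun     : Ty → ℕ → ℕ
    inv     : Ty → ℕ → ℕ
    inv-fun : ∀ A n → inv A (fun A n) ≡ n
    fun-inv : ∀ A n → fun A (inv A n) ≡ n
    finite  : Σ (List (Σ Ty λ _ → ℕ)) λ xs →
                ∀ A n → fun A n ≢ n → (A , n) ∈ xs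
open Perm public

module _ {K : Ty → Set} where

  infixr 9 _·_
  _·_ : ∀ {Γ A} → Perm → Tm K Γ A → Tm K Γ A
  π · var x   = var x
  _·_ {A = A} π (nom n) = nom (fun π A n)
  π · con c   = con c
  π · lam t   = lam (π · t)
  π · app t u = app (π · t) (π · u)

  infix 4 _≈_
  _≈_ : ∀ {Γ A} → Tm K Γ A → Tm K Γ A → Set
  t ≈ t' = Σ Perm λ π → t ≡βη (π · t')

  Admissible : ∀ {Γ Δ A} → Perm → Tm K Γ A → Sub {K} Γ Δ → Set
  Admissible π t θ = ∀ B n → Supp t B n → ¬ SuppSub θ B (fun π B n)

  nomSub : ∀ {Γ Δ A} → Tm K Γ A → Sub {K} Γ Δ → Perm → Tm K Δ A
  nomSub t θ π = sub θ (π · t)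

-- Write t ≡βη π · t'. Normal forms are unique and normalisation introduces no
-- nominal constants, so every name k of the normal form of t' lies in supp t',
-- and admissibility puts π₂ k and π₁ (π k) outside supp θ, which consists of
-- the names of the normal forms of the θ x. Exchanging π₂ k with a fresh N + k
-- and then N + k with π₁ (π k) gives a permutation σ that agrees with π₁ ∘ π
-- after π₂ on those names and fixes supp θ; hence
-- (π₁ · t)[θ] ≡βη (σ · π₂ · t')[θ] ≡βη σ · (π₂ · t')[θ].
-- Normal forms are computed by normalisation by evaluation.

module Submission where

open import Defs
open import Data.Nat using (ℕ; suc; _≤_; _<_; _∸_; _+_; _≤?_; s≤s)
import Data.Nat as ℕ
open import Data.Nat.Properties using (m+[n∸m]≡n; m+n∸m≡n; m≤m+n; <⇒≱; ≤-totalOrder)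
open import Data.List using (List; []; _∷_; _++_; map)
open import Data.List.Extrema ≤-totalOrder using (max; xs≤max)
open import Data.List.Membership.Propositional using (_∈_; _∉_)
open import Data.List.Membership.Propositional.Properties using (∈-++⁺ˡ; ∈-++⁺ʳ; ∈-++⁻; ∈-map⁺)
open import Data.List.Relation.Unary.All as All using ()
open import Data.List.Relation.Unary.Any using (here; there)
open import Data.Product using (Σ; _,_; _×_; proj₁; proj₂)
open import Data.Product.Properties using (≡-dec)
open import Data.Sum using (inj₁; inj₂)
open import Data.Empty using (⊥-elim)
open import Function using (id; _∘_)
open import Relation.Nullary using (¬_; yes; no)
open import Relation.Nullary.Decidable using (_×-dec_)
open import Relation.Binary.Bundles using (Setoid)
open import Relation.Binary.Definitions using (DecidableEquality)
import Relation.Binary.Reasoning.Setoid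
open import Relation.Binary.PropositionalEquality as ≡ using (_≡_; _≢_; refl; cong; cong₂; subst)

Name : Set
Name = Ty × ℕ

_≟ᵀ_ : DecidableEquality Ty
ι m ≟ᵀ ι n with m ℕ.≟ n
... | yes refl = yes refl
... | no m≢n   = no λ { refl → m≢n refl }
ι _ ≟ᵀ (_ ⇒ _) = no λ ()
(_ ⇒ _) ≟ᵀ ι _ = no λ ()
(A ⇒ B) ≟ᵀ (C ⇒ D) with A ≟ᵀ C | B ≟ᵀ D
... | yes refl | yes refl = yes refl
... | no A≢C   | _        = no λ { refl → A≢C refl }
... | yes _    | no B≢D   = no λ { refl → B≢D refl }

_≟ᴺ_ : DecidableEquality Name
_≟ᴺ_ = ≡-dec _≟ᵀ_ ℕ._≟_

open import Data.List.Membership.DecPropositional _≟ᴺ_ using (_∈?_)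

infixr 9 _∘ₚ_
_∘ₚ_ : Perm → Perm → Perm
π ∘ₚ ρ = record
  { fun     = λ A → fun π A ∘ fun ρ A
  ; inv     = λ A → inv ρ A ∘ inv π A
  ; inv-fun = λ A n → ≡.trans (cong (inv ρ A) (inv-fun π A (fun ρ A n))) (inv-fun ρ A n)
  ; fun-inv = λ A n → ≡.trans (cong (fun π A) (fun-inv ρ A (inv π A n))) (fun-inv π A n)
  ; finite  = proj₁ (finite ρ) ++ proj₁ (finite π) , moved
  }
  where
  moved : ∀ A n → fun π A (fun ρ A n) ≢ n → (A , n) ∈ proj₁ (finite ρ) ++ proj₁ (finite π)
  moved A n πρn≢n with fun ρ A n ℕ.≟ n
  ... | yes ρn≡n =
        ∈-++⁺ʳ _ (proj₂ (finite π) A n (λ πn≡n → πρn≢n (≡.trans (cong (fun π A) ρn≡n) πn≡n)))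
  ... | no ρn≢n  = ∈-++⁺ˡ (proj₂ (finite ρ) A n ρn≢n)

infix 10 _⁻¹ₚ
_⁻¹ₚ : Perm → Perm
π ⁻¹ₚ = record
  { fun     = inv π
  ; inv     = fun π
  ; inv-fun = fun-inv π
  ; fun-inv = inv-fun π
  ; finite  = proj₁ (finite π) , λ A n π⁻¹n≢n →
      proj₂ (finite π) A n (λ πn≡n → π⁻¹n≢n (≡.trans (cong (inv π A) (≡.sym πn≡n)) (inv-fun π A n)))
  }

image : Perm → List Name → List Name
image π = map (λ (A , k) → A , fun π A k)

bound : List Name → ℕ
bound xs = suc (max 0 (map proj₂ xs))

∈⇒<bound : ∀ {xs A n} → (A , n) ∈ xs → n < bound xs
∈⇒<bound {xs} m = s≤s (All.lookup (xs≤max 0 (map proj₂ xs)) (∈-map⁺ proj₂ m))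

-- For g(D) below N, the involution exchanging g k with N + k for every k ∈ D.
module Shift (g : Perm) (D : List Name) (N : ℕ)
             (g[D]<N : ∀ {A k} → (A , k) ∈ D → fun g A k < N) where

  IsShifted : Ty → ℕ → Set
  IsShifted A n = N ≤ n × (A , n ∸ N) ∈ D

  shift : Ty → ℕ → ℕ
  shift A n with (N ≤? n) ×-dec ((A , n ∸ N) ∈? D)
  ... | yes _ = fun g A (n ∸ N)
  ... | no _ with (A , inv g A n) ∈? D
  ...   | yes _ = N + inv g A n
  ...   | no _  = n

  shift-shifted : ∀ {A n} → IsShifted A n → shift A n ≡ fun g A (n ∸ N)
  shift-shifted {A} {n} s with (N ≤? n) ×-dec ((A , n ∸ N) ∈? D)
  ... | yes _ = refl
  ... | no ¬s = ⊥-elim (¬s s)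

  shift-image : ∀ {A n} → ¬ IsShifted A n → (A , inv g A n) ∈ D → shift A n ≡ N + inv g A n
  shift-image {A} {n} ¬s m with (N ≤? n) ×-dec ((A , n ∸ N) ∈? D)
  ... | yes s = ⊥-elim (¬s s)
  ... | no _ with (A , inv g A n) ∈? D
  ...   | yes _ = refl
  ...   | no ¬m = ⊥-elim (¬m m)

  shift-other : ∀ {A n} → ¬ IsShifted A n → (A , inv g A n) ∉ D → shift A n ≡ n
  shift-other {A} {n} ¬s ¬m with (N ≤? n) ×-dec ((A , n ∸ N) ∈? D)
  ... | yes s = ⊥-elim (¬s s)
  ... | no _ with (A , inv g A n) ∈? D
  ...   | yes m = ⊥-elim (¬m m)
  ...   | no _  = refl

  <N⇒¬shifted : ∀ {A n} → n < N → ¬ IsShifted A n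
  <N⇒¬shifted n<N (N≤n , _) = <⇒≱ n<N N≤n

  shift-g : ∀ {A k} → (A , k) ∈ D → shift A (fun g A k) ≡ N + k
  shift-g {A} {k} m =
    ≡.trans (shift-image (<N⇒¬shifted (g[D]<N m)) (subst (λ z → (A , z) ∈ D) (≡.sym (inv-fun g A k)) m))
            (cong (N +_) (inv-fun g A k))

  shift-N+ : ∀ {A k} → (A , k) ∈ D → shift A (N + k) ≡ fun g A k
  shift-N+ {A} {k} m =
    ≡.trans (shift-shifted (m≤m+n N k , subst (λ z → (A , z) ∈ D) (≡.sym (m+n∸m≡n N k)) m))
            (cong (fun g A) (m+n∸m≡n N k))

  shift-fixes : ∀ {A n} → n < N → (A , inv g A n) ∉ D → shift A n ≡ n
  shift-fixes n<N = shift-other (<N⇒¬shifted n<N)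

  shift-involutive : ∀ A n → shift A (shift A n) ≡ n
  shift-involutive A n with (N ≤? n) ×-dec ((A , n ∸ N) ∈? D)
  ... | yes (N≤n , m) = ≡.trans (shift-g m) (m+[n∸m]≡n N≤n)
  ... | no ¬s with (A , inv g A n) ∈? D
  ...   | yes m = ≡.trans (shift-N+ m) (fun-inv g A n)
  ...   | no ¬m = shift-other ¬s ¬m

  shifted : List Name
  shifted = map (λ (B , k) → B , N + k) D

  moved : ∀ A n → shift A n ≢ n → (A , n) ∈ shifted ++ image g D
  moved A n shifts with (N ≤? n) ×-dec ((A , n ∸ N) ∈? D)
  ... | yes (N≤n , m) =
        ∈-++⁺ˡ (subst (λ z → (A , z) ∈ shifted) (m+[n∸m]≡n N≤n) (∈-map⁺ (λ (B , k) → B , N + k) m))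
  ... | no _ with (A , inv g A n) ∈? D
  ...   | yes m =
          ∈-++⁺ʳ shifted (subst (λ z → (A , z) ∈ image g D) (fun-inv g A n)
                                (∈-map⁺ (λ (B , k) → B , fun g B k) m))
  ...   | no _  = ⊥-elim (shifts refl)

  shiftₚ : Perm
  shiftₚ = record
    { fun = shift ; inv = shift ; inv-fun = shift-involutive ; fun-inv = shift-involutive
    ; finite = _ , moved }

∃-perm-carrying : (g h : Perm) (D S : List Name) →
                  (∀ {A k} → (A , k) ∈ D → (A , fun g A k) ∉ S) →
                  (∀ {A k} → (A , k) ∈ D → (A , fun h A k) ∉ S) →
                  Σ Perm λ σ → (∀ {A k} → (A , k) ∈ D → fun σ A (fun h A k) ≡ fun g A k)
                             × (∀ {A n} → (A , n) ∈ S → fun σ A n ≡ n)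
∃-perm-carrying g h D S g[D]∉S h[D]∉S = Sg.shiftₚ ∘ₚ Sh.shiftₚ , carries , fixes
  where
  N = bound (image g D ++ image h D ++ S)
  module Sg = Shift g D N (λ m → ∈⇒<bound (∈-++⁺ˡ (∈-map⁺ _ m)))
  module Sh = Shift h D N (λ m → ∈⇒<bound (∈-++⁺ʳ (image g D) (∈-++⁺ˡ (∈-map⁺ _ m))))

  carries : ∀ {A k} → (A , k) ∈ D → Sg.shift A (Sh.shift A (fun h A k)) ≡ fun g A k
  carries m = ≡.trans (cong (Sg.shift _) (Sh.shift-g m)) (Sg.shift-N+ m)

  preimage∉D : ∀ (π : Perm) → (∀ {A k} → (A , k) ∈ D → (A , fun π A k) ∉ S) →
               ∀ {A n} → (A , n) ∈ S → (A , inv π A n) ∉ D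
  preimage∉D π π[D]∉S {A} {n} n∈S m = π[D]∉S m (subst (λ z → (A , z) ∈ S) (≡.sym (fun-inv π A n)) n∈S)

  fixes : ∀ {A n} → (A , n) ∈ S → Sg.shift A (Sh.shift A n) ≡ n
  fixes n∈S = ≡.trans (cong (Sg.shift _) (Sh.shift-fixes n<N (preimage∉D h h[D]∉S n∈S)))
                      (Sg.shift-fixes n<N (preimage∉D g g[D]∉S n∈S))
    where n<N = ∈⇒<bound (∈-++⁺ʳ (image g D) (∈-++⁺ʳ (image h D) n∈S))

module _ {K : Ty → Set} where

  ext-cong : ∀ {Γ Δ B} {ρ ρ' : Ren {K} Γ Δ} → (∀ {A} (x : Γ ∋ A) → ρ x ≡ ρ' x) →
             ∀ {A} (x : (B ∷ Γ) ∋ A) → ext {K} ρ x ≡ ext {K} ρ' x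
  ext-cong h here      = refl
  ext-cong h (there x) = cong there (h x)

  ren-cong : ∀ {Γ Δ A} {ρ ρ' : Ren {K} Γ Δ} → (∀ {A} (x : Γ ∋ A) → ρ x ≡ ρ' x) →
             (t : Tm K Γ A) → ren ρ t ≡ ren ρ' t
  ren-cong h (var x)   = cong var (h x)
  ren-cong h (nom n)   = refl
  ren-cong h (con c)   = refl
  ren-cong h (lam t)   = cong lam (ren-cong (ext-cong h) t)
  ren-cong h (app t u) = cong₂ app (ren-cong h t) (ren-cong h u)

  ren-ren : ∀ {Γ Δ Θ A} (ρ : Ren {K} Δ Θ) (ρ' : Ren {K} Γ Δ) (t : Tm K Γ A) →
            ren ρ (ren ρ' t) ≡ ren (ρ ∘ ρ') t
  ren-ren ρ ρ' (var x)   = refl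
  ren-ren ρ ρ' (nom n)   = refl
  ren-ren ρ ρ' (con c)   = refl
  ren-ren ρ ρ' (lam t)   = cong lam (≡.trans (ren-ren (ext ρ) (ext ρ') t)
                                             (ren-cong (λ { here → refl ; (there x) → refl }) t))
  ren-ren ρ ρ' (app t u) = cong₂ app (ren-ren ρ ρ' t) (ren-ren ρ ρ' u)

  ren-id : ∀ {Γ A} (t : Tm K Γ A) → ren id t ≡ t
  ren-id (var x)   = refl
  ren-id (nom n)   = refl
  ren-id (con c)   = refl
  ren-id (lam t)   = cong lam (≡.trans (ren-cong (λ { here → refl ; (there x) → refl }) t) (ren-id t))
  ren-id (app t u) = cong₂ app (ren-id t) (ren-id u)

  exts-cong : ∀ {Γ Δ B} {σ σ' : Sub {K} Γ Δ} → (∀ {A} (x : Γ ∋ A) → σ x ≡ σ' x) →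
              ∀ {A} (x : (B ∷ Γ) ∋ A) → exts σ x ≡ exts σ' x
  exts-cong h here      = refl
  exts-cong h (there x) = cong (ren there) (h x)

  sub-cong : ∀ {Γ Δ A} {σ σ' : Sub {K} Γ Δ} → (∀ {A} (x : Γ ∋ A) → σ x ≡ σ' x) →
             (t : Tm K Γ A) → sub σ t ≡ sub σ' t
  sub-cong h (var x)   = h x
  sub-cong h (nom n)   = refl
  sub-cong h (con c)   = refl
  sub-cong h (lam t)   = cong lam (sub-cong (exts-cong h) t)
  sub-cong h (app t u) = cong₂ app (sub-cong h t) (sub-cong h u)

  ren-sub : ∀ {Γ Δ Θ A} (ρ : Ren {K} Δ Θ) (σ : Sub {K} Γ Δ) (t : Tm K Γ A) →
            ren ρ (sub σ t) ≡ sub (ren ρ ∘ σ) t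
  ren-sub ρ σ (var x)   = refl
  ren-sub ρ σ (nom n)   = refl
  ren-sub ρ σ (con c)   = refl
  ren-sub ρ σ (lam t)   = cong lam (≡.trans (ren-sub (ext ρ) (exts σ) t)
    (sub-cong (λ { here → refl
                 ; (there x) → ≡.trans (ren-ren (ext ρ) there (σ x)) (≡.sym (ren-ren there ρ (σ x))) }) t))
  ren-sub ρ σ (app t u) = cong₂ app (ren-sub ρ σ t) (ren-sub ρ σ u)

  sub-ren : ∀ {Γ Δ Θ A} (σ : Sub {K} Δ Θ) (ρ : Ren {K} Γ Δ) (t : Tm K Γ A) →
            sub σ (ren ρ t) ≡ sub (σ ∘ ρ) t
  sub-ren σ ρ (var x)   = refl
  sub-ren σ ρ (nom n)   = refl
  sub-ren σ ρ (con c)   = refl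
  sub-ren σ ρ (lam t)   = cong lam (≡.trans (sub-ren (exts σ) (ext ρ) t)
                                             (sub-cong (λ { here → refl ; (there x) → refl }) t))
  sub-ren σ ρ (app t u) = cong₂ app (sub-ren σ ρ t) (sub-ren σ ρ u)

  sub-sub : ∀ {Γ Δ Θ A} (σ : Sub {K} Δ Θ) (τ : Sub {K} Γ Δ) (t : Tm K Γ A) →
            sub σ (sub τ t) ≡ sub (sub σ ∘ τ) t
  sub-sub σ τ (var x)   = refl
  sub-sub σ τ (nom n)   = refl
  sub-sub σ τ (con c)   = refl
  sub-sub σ τ (lam t)   = cong lam (≡.trans (sub-sub (exts σ) (exts τ) t)
    (sub-cong (λ { here → refl
                 ; (there x) → ≡.trans (sub-ren (exts σ) there (τ x)) (≡.sym (ren-sub there σ (τ x))) }) t))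
  sub-sub σ τ (app t u) = cong₂ app (sub-sub σ τ t) (sub-sub σ τ u)

  sub-var : ∀ {Γ A} (t : Tm K Γ A) → sub var t ≡ t
  sub-var (var x)   = refl
  sub-var (nom n)   = refl
  sub-var (con c)   = refl
  sub-var (lam t)   = cong lam (≡.trans (sub-cong (λ { here → refl ; (there x) → refl }) t) (sub-var t))
  sub-var (app t u) = cong₂ app (sub-var t) (sub-var u)

  sub-var∘ : ∀ {Γ Δ A} (ρ : Ren {K} Γ Δ) (t : Tm K Γ A) → sub (var ∘ ρ) t ≡ ren ρ t
  sub-var∘ ρ (var x)   = refl
  sub-var∘ ρ (nom n)   = refl
  sub-var∘ ρ (con c)   = refl
  sub-var∘ ρ (lam t)   = cong lam (≡.trans (sub-cong (λ { here → refl ; (there x) → refl }) t)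
                                             (sub-var∘ (ext ρ) t))
  sub-var∘ ρ (app t u) = cong₂ app (sub-var∘ ρ t) (sub-var∘ ρ u)


  ≡⇒≡βη : ∀ {Γ A} {t u : Tm K Γ A} → t ≡ u → t ≡βη u
  ≡⇒≡βη refl = refl

  ren-≡βη : ∀ {Γ Δ A} (ρ : Ren {K} Γ Δ) {t t' : Tm K Γ A} → t ≡βη t' → ren ρ t ≡βη ren ρ t'
  ren-≡βη ρ (β t u) = trans (β _ _) (≡⇒≡βη (≡.trans (sub-ren _ (ext ρ) t)
    (≡.trans (sub-cong (λ { here → refl ; (there x) → refl }) t) (≡.sym (ren-sub ρ (single u) t)))))
  ren-≡βη ρ (η t) = trans (≡⇒≡βη (cong (λ z → lam (app z (var here)))
    (≡.trans (ren-ren (ext ρ) there t) (≡.sym (ren-ren there ρ t))))) (η _)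
  ren-≡βη ρ refl           = refl
  ren-≡βη ρ (sym p)        = sym (ren-≡βη ρ p)
  ren-≡βη ρ (trans p q)    = trans (ren-≡βη ρ p) (ren-≡βη ρ q)
  ren-≡βη ρ (lam-cong p)   = lam-cong (ren-≡βη (ext ρ) p)
  ren-≡βη ρ (app-cong p q) = app-cong (ren-≡βη ρ p) (ren-≡βη ρ q)

  sub-≡βη : ∀ {Γ Δ A} (σ : Sub {K} Γ Δ) {t t' : Tm K Γ A} → t ≡βη t' → sub σ t ≡βη sub σ t'
  sub-≡βη σ (β t u) = trans (β _ _) (≡⇒≡βη (≡.trans (sub-sub _ (exts σ) t)
    (≡.trans (sub-cong (λ { here → refl ; (there x) → ≡.trans (sub-ren _ there (σ x)) (sub-var (σ x)) }) t)
             (≡.sym (sub-sub σ (single u) t)))))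
  sub-≡βη σ (η t) = trans (≡⇒≡βη (cong (λ z → lam (app z (var here)))
    (≡.trans (sub-ren (exts σ) there t) (≡.sym (ren-sub there σ t))))) (η _)
  sub-≡βη σ refl           = refl
  sub-≡βη σ (sym p)        = sym (sub-≡βη σ p)
  sub-≡βη σ (trans p q)    = trans (sub-≡βη σ p) (sub-≡βη σ q)
  sub-≡βη σ (lam-cong p)   = lam-cong (sub-≡βη (exts σ) p)
  sub-≡βη σ (app-cong p q) = app-cong (sub-≡βη σ p) (sub-≡βη σ q)

  sub-cong-≡βη : ∀ {Γ Δ A} {σ σ' : Sub {K} Γ Δ} → (∀ {A} (x : Γ ∋ A) → σ x ≡βη σ' x) →
                 (t : Tm K Γ A) → sub σ t ≡βη sub σ' t
  sub-cong-≡βη h (var x)   = h x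
  sub-cong-≡βη h (nom n)   = refl
  sub-cong-≡βη h (con c)   = refl
  sub-cong-≡βη h (lam t)   = lam-cong (sub-cong-≡βη (λ { here → refl ; (there x) → ren-≡βη there (h x) }) t)
  sub-cong-≡βη h (app t u) = app-cong (sub-cong-≡βη h t) (sub-cong-≡βη h u)

  ·-ren : ∀ {Γ Δ A} (π : Perm) (ρ : Ren {K} Γ Δ) (t : Tm K Γ A) → π · ren ρ t ≡ ren ρ (π · t)
  ·-ren π ρ (var x)   = refl
  ·-ren π ρ (nom n)   = refl
  ·-ren π ρ (con c)   = refl
  ·-ren π ρ (lam t)   = cong lam (·-ren π (ext ρ) t)
  ·-ren π ρ (app t u) = cong₂ app (·-ren π ρ t) (·-ren π ρ u)

  ·-sub : ∀ {Γ Δ A} (π : Perm) (σ : Sub {K} Γ Δ) (t : Tm K Γ A) →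
          π · sub σ t ≡ sub ((π ·_) ∘ σ) (π · t)
  ·-sub π σ (var x)   = refl
  ·-sub π σ (nom n)   = refl
  ·-sub π σ (con c)   = refl
  ·-sub π σ (lam t)   = cong lam (≡.trans (·-sub π (exts σ) t)
    (sub-cong (λ { here → refl ; (there x) → ·-ren π there (σ x) }) (π · t)))
  ·-sub π σ (app t u) = cong₂ app (·-sub π σ t) (·-sub π σ u)

  ·-≡βη : ∀ {Γ A} (π : Perm) {t t' : Tm K Γ A} → t ≡βη t' → π · t ≡βη π · t'
  ·-≡βη π (β t u) = trans (β _ _) (≡⇒≡βη (≡.trans
    (sub-cong (λ { here → refl ; (there x) → refl }) (π · t)) (≡.sym (·-sub π (single u) t))))
  ·-≡βη π (η t)          = trans (≡⇒≡βη (cong (λ z → lam (app z (var here))) (·-ren π there t))) (η _)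
  ·-≡βη π refl           = refl
  ·-≡βη π (sym p)        = sym (·-≡βη π p)
  ·-≡βη π (trans p q)    = trans (·-≡βη π p) (·-≡βη π q)
  ·-≡βη π (lam-cong p)   = lam-cong (·-≡βη π p)
  ·-≡βη π (app-cong p q) = app-cong (·-≡βη π p) (·-≡βη π q)

  ·-∘ₚ : ∀ {Γ A} (π ρ : Perm) (t : Tm K Γ A) → (π ∘ₚ ρ) · t ≡ π · ρ · t
  ·-∘ₚ π ρ (var x)   = refl
  ·-∘ₚ π ρ (nom n)   = refl
  ·-∘ₚ π ρ (con c)   = refl
  ·-∘ₚ π ρ (lam t)   = cong lam (·-∘ₚ π ρ t)
  ·-∘ₚ π ρ (app t u) = cong₂ app (·-∘ₚ π ρ t) (·-∘ₚ π ρ u)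

  ·-cong : ∀ {Γ A} {π ρ : Perm} (t : Tm K Γ A) →
           (∀ {B n} → Occurs B n t → fun π B n ≡ fun ρ B n) → π · t ≡ ρ · t
  ·-cong (var x)   h = refl
  ·-cong (nom n)   h = cong nom (h occ-nom)
  ·-cong (con c)   h = refl
  ·-cong (lam t)   h = cong lam (·-cong t (h ∘ occ-lam))
  ·-cong (app t u) h = cong₂ app (·-cong t (h ∘ occ-appl)) (·-cong u (h ∘ occ-appr))

  ·-fixes : ∀ {Γ A} {π : Perm} (t : Tm K Γ A) → (∀ {B n} → Occurs B n t → fun π B n ≡ n) → π · t ≡ t
  ·-fixes (var x)   h = refl
  ·-fixes (nom n)   h = cong nom (h occ-nom)
  ·-fixes (con c)   h = refl
  ·-fixes (lam t)   h = cong lam (·-fixes t (h ∘ occ-lam))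
  ·-fixes (app t u) h = cong₂ app (·-fixes t (h ∘ occ-appl)) (·-fixes u (h ∘ occ-appr))

  ⁻¹ₚ-· : ∀ {Γ A} (π : Perm) (t : Tm K Γ A) → π ⁻¹ₚ · π · t ≡ t
  ⁻¹ₚ-· π t = ≡.trans (≡.sym (·-∘ₚ (π ⁻¹ₚ) π t)) (·-fixes t λ {B} {n} _ → inv-fun π B n)

  Occurs-·⁻ : ∀ {Γ A B n} (π : Perm) (t : Tm K Γ A) → Occurs B n (π · t) → Occurs B (inv π B n) t
  Occurs-·⁻ {B = B} π (nom m) occ-nom = subst (λ k → Occurs B k (nom m)) (≡.sym (inv-fun π B m)) occ-nom
  Occurs-·⁻ π (lam t)   (occ-lam o)  = occ-lam (Occurs-·⁻ π t o)
  Occurs-·⁻ π (app t u) (occ-appl o) = occ-appl (Occurs-·⁻ π t o)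
  Occurs-·⁻ π (app t u) (occ-appr o) = occ-appr (Occurs-·⁻ π u o)

  Occurs-ren⁻ : ∀ {Γ Δ A B n} (ρ : Ren {K} Γ Δ) (t : Tm K Γ A) → Occurs B n (ren ρ t) → Occurs B n t
  Occurs-ren⁻ ρ (nom m)   occ-nom      = occ-nom
  Occurs-ren⁻ ρ (lam t)   (occ-lam o)  = occ-lam (Occurs-ren⁻ (ext ρ) t o)
  Occurs-ren⁻ ρ (app t u) (occ-appl o) = occ-appl (Occurs-ren⁻ ρ t o)
  Occurs-ren⁻ ρ (app t u) (occ-appr o) = occ-appr (Occurs-ren⁻ ρ u o)

  names : ∀ {Γ A} → Tm K Γ A → List Name
  names (var x)           = []
  names {A = A} (nom n)   = (A , n) ∷ []
  names (con c)           = []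
  names (lam t)           = names t
  names (app t u)         = names t ++ names u

  ∈names⇒Occurs : ∀ {Γ A B n} (t : Tm K Γ A) → (B , n) ∈ names t → Occurs B n t
  ∈names⇒Occurs (nom n)   (here refl) = occ-nom
  ∈names⇒Occurs (lam t)   m           = occ-lam (∈names⇒Occurs t m)
  ∈names⇒Occurs (app t u) m with ∈-++⁻ (names t) m
  ... | inj₁ m' = occ-appl (∈names⇒Occurs t m')
  ... | inj₂ m' = occ-appr (∈names⇒Occurs u m')

  Occurs⇒∈names : ∀ {Γ A B n} (t : Tm K Γ A) → Occurs B n t → (B , n) ∈ names t
  Occurs⇒∈names (nom n)   occ-nom      = here refl
  Occurs⇒∈names (lam t)   (occ-lam o)  = Occurs⇒∈names t o
  Occurs⇒∈names (app t u) (occ-appl o) = ∈-++⁺ˡ (Occurs⇒∈names t o)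
  Occurs⇒∈names (app t u) (occ-appr o) = ∈-++⁺ʳ (names t) (Occurs⇒∈names u o)

-- Normalisation by evaluation

module _ (K : Ty → Set) where

  data Ne (Γ : Ctx) : Ty → Set
  data Nf (Γ : Ctx) : Ty → Set

  data Ne Γ where
    nvar : ∀ {A} → Γ ∋ A → Ne Γ A
    nnom : ∀ {A} → ℕ → Ne Γ A
    ncon : ∀ {A} → K A → Ne Γ A
    napp : ∀ {A B} → Ne Γ (A ⇒ B) → Nf Γ A → Ne Γ B

  data Nf Γ where
    neu  : ∀ {n} → Ne Γ (ι n) → Nf Γ (ι n)
    nlam : ∀ {A B} → Nf (A ∷ Γ) B → Nf Γ (A ⇒ B)

module _ {K : Ty → Set} where

  ⌜_⌝ⁿᵉ : ∀ {Γ A} → Ne K Γ A → Tm K Γ A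
  ⌜_⌝   : ∀ {Γ A} → Nf K Γ A → Tm K Γ A
  ⌜ nvar x ⌝ⁿᵉ   = var x
  ⌜ nnom n ⌝ⁿᵉ   = nom n
  ⌜ ncon c ⌝ⁿᵉ   = con c
  ⌜ napp n v ⌝ⁿᵉ = app ⌜ n ⌝ⁿᵉ ⌜ v ⌝
  ⌜ neu n ⌝      = ⌜ n ⌝ⁿᵉ
  ⌜ nlam v ⌝     = lam ⌜ v ⌝

  renNe : ∀ {Γ Δ A} → Ren {K} Γ Δ → Ne K Γ A → Ne K Δ A
  renNf : ∀ {Γ Δ A} → Ren {K} Γ Δ → Nf K Γ A → Nf K Δ A
  renNe ρ (nvar x)   = nvar (ρ x)
  renNe ρ (nnom n)   = nnom n
  renNe ρ (ncon c)   = ncon c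
  renNe ρ (napp n v) = napp (renNe ρ n) (renNf ρ v)
  renNf ρ (neu n)    = neu (renNe ρ n)
  renNf ρ (nlam v)   = nlam (renNf (ext {K} ρ) v)

  ⌜renNe⌝ : ∀ {Γ Δ A} (ρ : Ren {K} Γ Δ) (n : Ne K Γ A) → ⌜ renNe ρ n ⌝ⁿᵉ ≡ ren ρ ⌜ n ⌝ⁿᵉ
  ⌜renNf⌝ : ∀ {Γ Δ A} (ρ : Ren {K} Γ Δ) (v : Nf K Γ A) → ⌜ renNf ρ v ⌝ ≡ ren ρ ⌜ v ⌝
  ⌜renNe⌝ ρ (nvar x)   = refl
  ⌜renNe⌝ ρ (nnom n)   = refl
  ⌜renNe⌝ ρ (ncon c)   = refl
  ⌜renNe⌝ ρ (napp n v) = cong₂ app (⌜renNe⌝ ρ n) (⌜renNf⌝ ρ v)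
  ⌜renNf⌝ ρ (neu n)    = ⌜renNe⌝ ρ n
  ⌜renNf⌝ ρ (nlam v)   = cong lam (⌜renNf⌝ (ext ρ) v)

  renNe-cong : ∀ {Γ Δ A} {ρ ρ' : Ren {K} Γ Δ} → (∀ {A} (x : Γ ∋ A) → ρ x ≡ ρ' x) →
               (n : Ne K Γ A) → renNe ρ n ≡ renNe ρ' n
  renNf-cong : ∀ {Γ Δ A} {ρ ρ' : Ren {K} Γ Δ} → (∀ {A} (x : Γ ∋ A) → ρ x ≡ ρ' x) →
               (v : Nf K Γ A) → renNf ρ v ≡ renNf ρ' v
  renNe-cong h (nvar x)   = cong nvar (h x)
  renNe-cong h (nnom n)   = refl
  renNe-cong h (ncon c)   = refl
  renNe-cong h (napp n v) = cong₂ napp (renNe-cong h n) (renNf-cong h v)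
  renNf-cong h (neu n)    = cong neu (renNe-cong h n)
  renNf-cong h (nlam v)   = cong nlam (renNf-cong (ext-cong h) v)

  renNe-renNe : ∀ {Γ Δ Θ A} (ρ : Ren {K} Δ Θ) (ρ' : Ren {K} Γ Δ) (n : Ne K Γ A) →
                renNe ρ (renNe ρ' n) ≡ renNe (ρ ∘ ρ') n
  renNf-renNf : ∀ {Γ Δ Θ A} (ρ : Ren {K} Δ Θ) (ρ' : Ren {K} Γ Δ) (v : Nf K Γ A) →
                renNf ρ (renNf ρ' v) ≡ renNf (ρ ∘ ρ') v
  renNe-renNe ρ ρ' (nvar x)   = refl
  renNe-renNe ρ ρ' (nnom n)   = refl
  renNe-renNe ρ ρ' (ncon c)   = refl
  renNe-renNe ρ ρ' (napp n v) = cong₂ napp (renNe-renNe ρ ρ' n) (renNf-renNf ρ ρ' v)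
  renNf-renNf ρ ρ' (neu n)    = cong neu (renNe-renNe ρ ρ' n)
  renNf-renNf ρ ρ' (nlam v)   = cong nlam (≡.trans (renNf-renNf (ext ρ) (ext ρ') v)
                                                   (renNf-cong (λ { here → refl ; (there x) → refl }) v))

  renNe-id : ∀ {Γ A} (n : Ne K Γ A) → renNe id n ≡ n
  renNf-id : ∀ {Γ A} (v : Nf K Γ A) → renNf id v ≡ v
  renNe-id (nvar x)   = refl
  renNe-id (nnom n)   = refl
  renNe-id (ncon c)   = refl
  renNe-id (napp n v) = cong₂ napp (renNe-id n) (renNf-id v)
  renNf-id (neu n)    = cong neu (renNe-id n)
  renNf-id (nlam v)   = cong nlam (≡.trans (renNf-cong (λ { here → refl ; (there x) → refl }) v) (renNf-id v))

  Val : Ctx → Ty → Set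
  Val Γ (ι n)   = Ne K Γ (ι n)
  Val Γ (A ⇒ B) = ∀ {Δ} → Ren {K} Γ Δ → Val Δ A → Val Δ B

  renVal : ∀ {Γ Δ} A → Ren {K} Γ Δ → Val Γ A → Val Δ A
  renVal (ι n)   ρ v = renNe ρ v
  renVal (A ⇒ B) ρ f = λ ρ' → f (ρ' ∘ ρ)

  reflect : ∀ {Γ} A → Ne K Γ A → Val Γ A
  reify   : ∀ {Γ} A → Val Γ A → Nf K Γ A
  reflect (ι n)   n' = n'
  reflect (A ⇒ B) n' = λ ρ a → reflect B (napp (renNe ρ n') (reify A a))
  reify (ι n)   v = neu v
  reify (A ⇒ B) f = nlam (reify B (f there (reflect A (nvar here))))

  Env : Ctx → Ctx → Set
  Env Γ Δ = ∀ {A} → Γ ∋ A → Val Δ A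

  infixr 5 _∷ᵉ_
  _∷ᵉ_ : ∀ {Γ Δ A} → Val Δ A → Env Γ Δ → Env (A ∷ Γ) Δ
  (a ∷ᵉ e) here      = a
  (a ∷ᵉ e) (there x) = e x

  renEnv : ∀ {Γ Δ Θ} → Ren {K} Δ Θ → Env Γ Δ → Env Γ Θ
  renEnv ρ e {A} x = renVal A ρ (e x)

  eval : ∀ {Γ Δ A} → Tm K Γ A → Env Γ Δ → Val Δ A
  eval (var x)           e = e x
  eval {A = A} (nom n)   e = reflect A (nnom n)
  eval {A = A} (con c)   e = reflect A (ncon c)
  eval (lam t)           e = λ ρ a → eval t (a ∷ᵉ renEnv ρ e)
  eval (app t u)         e = eval t e id (eval u e)

  idEnv : ∀ {Γ} → Env Γ Γ
  idEnv {A = A} x = reflect A (nvar x)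

  nf : ∀ {Γ A} → Tm K Γ A → Nf K Γ A
  nf {A = A} t = reify A (eval t idEnv)

  -- Uniqueness of normal forms

  -- A partial equivalence on values; at arrow types it also demands
  -- naturality under renaming, which is not automatic for Kripke functions.
  EqVal : ∀ {Γ} A → Val Γ A → Val Γ A → Set
  EqVal (ι n) v w = v ≡ w
  EqVal {Γ} (A ⇒ B) f g =
    (∀ {Δ} (ρ : Ren {K} Γ Δ) {a b} → EqVal A a b → EqVal B (f ρ a) (g ρ b)) ×
    (∀ {Δ Δ'} (ρ : Ren {K} Γ Δ) (ρ' : Ren {K} Δ Δ') {a b} → EqVal A a b →
       EqVal B (renVal B ρ' (f ρ a)) (g (ρ' ∘ ρ) (renVal A ρ' b)))

  EqVal-ren : ∀ {Γ Δ} A (ρ : Ren {K} Γ Δ) {v w} → EqVal A v w → EqVal A (renVal A ρ v) (renVal A ρ w)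
  EqVal-ren (ι n)   ρ v≡w        = cong (renNe ρ) v≡w
  EqVal-ren (A ⇒ B) ρ (ext≈ , nat) = (λ ρ' → ext≈ (ρ' ∘ ρ)) , (λ ρ' → nat (ρ' ∘ ρ))

  EqVal-sym   : ∀ {Γ} A {v w : Val Γ A} → EqVal A v w → EqVal A w v
  EqVal-trans : ∀ {Γ} A {u v w : Val Γ A} → EqVal A u v → EqVal A v w → EqVal A u w
  EqVal-sym (ι n) e = ≡.sym e
  EqVal-sym (A ⇒ B) (ext≈ , nat) =
    (λ ρ ab → EqVal-sym B (ext≈ ρ (EqVal-sym A ab))) ,
    (λ ρ ρ' ab →
      EqVal-trans B (EqVal-ren B ρ' (EqVal-sym B (ext≈ ρ (EqVal-sym A ab))))
        (EqVal-trans B (nat ρ ρ' (EqVal-sym A ab))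
          (EqVal-sym B (ext≈ (ρ' ∘ ρ) (EqVal-ren A ρ' (EqVal-sym A ab))))))
  EqVal-trans (ι n) e e' = ≡.trans e e'
  EqVal-trans (A ⇒ B) (ext≈ , nat) (ext≈' , _) =
    (λ ρ ab → EqVal-trans B (ext≈ ρ (EqVal-trans A ab (EqVal-sym A ab))) (ext≈' ρ ab)) ,
    (λ ρ ρ' ab → EqVal-trans B (nat ρ ρ' ab) (ext≈' _ (EqVal-ren A ρ' (EqVal-trans A (EqVal-sym A ab) ab))))

  EqVal-reflˡ : ∀ {Γ} A {v w : Val Γ A} → EqVal A v w → EqVal A v v
  EqVal-reflˡ A e = EqVal-trans A e (EqVal-sym A e)

  EqVal-reflʳ : ∀ {Γ} A {v w : Val Γ A} → EqVal A v w → EqVal A w w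
  EqVal-reflʳ A e = EqVal-trans A (EqVal-sym A e) e

  renVal-renVal : ∀ {Γ Δ Θ} A (ρ : Ren {K} Γ Δ) (ρ' : Ren {K} Δ Θ) {v} → EqVal A v v →
                  EqVal A (renVal A ρ' (renVal A ρ v)) (renVal A (ρ' ∘ ρ) v)
  renVal-renVal (ι n)   ρ ρ' {v} _ = renNe-renNe ρ' ρ v
  renVal-renVal (A ⇒ B) ρ ρ' v≈v   = EqVal-ren (A ⇒ B) (ρ' ∘ ρ) v≈v

  renVal-id : ∀ {Γ} A {v : Val Γ A} → EqVal A v v → EqVal A (renVal A id v) v
  renVal-id (ι n)   {v} _ = renNe-id v
  renVal-id (A ⇒ B) v≈v   = v≈v

  EqVal-⇒ : ∀ {Γ} A B {f g : Val Γ (A ⇒ B)} → EqVal (A ⇒ B) g g →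
            (∀ {Δ} (ρ : Ren {K} Γ Δ) {a b} → EqVal A a b → EqVal B (f ρ a) (g ρ b)) → EqVal (A ⇒ B) f g
  EqVal-⇒ A B (_ , natg) ext≈ =
    ext≈ , (λ ρ ρ' ab → EqVal-trans B (EqVal-ren B ρ' (ext≈ ρ ab)) (natg ρ ρ' (EqVal-reflʳ A ab)))

  reflect-EqVal : ∀ {Γ} A (n : Ne K Γ A) → EqVal A (reflect A n) (reflect A n)
  reify-EqVal   : ∀ {Γ} A {v w : Val Γ A} → EqVal A v w → reify A v ≡ reify A w
  reflect-renNe : ∀ {Γ Δ} A (ρ : Ren {K} Γ Δ) (n : Ne K Γ A) →
                  EqVal A (renVal A ρ (reflect A n)) (reflect A (renNe ρ n))
  reify-renVal  : ∀ {Γ Δ} A (ρ : Ren {K} Γ Δ) {v : Val Γ A} → EqVal A v v →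
                  renNf ρ (reify A v) ≡ reify A (renVal A ρ v)

  reflect-≡ : ∀ {Γ} A {n n' : Ne K Γ A} → n ≡ n' → EqVal A (reflect A n) (reflect A n')
  reflect-≡ A {n} refl = reflect-EqVal A n

  reflect-EqVal (ι n)   n' = refl
  reflect-EqVal (A ⇒ B) n' =
    (λ ρ ab → reflect-≡ B (cong (napp (renNe ρ n')) (reify-EqVal A ab))) ,
    (λ ρ ρ' {a} ab → EqVal-trans B (reflect-renNe B ρ' (napp (renNe ρ n') (reify A a)))
       (reflect-≡ B (cong₂ napp (renNe-renNe ρ' ρ n')
          (≡.trans (reify-renVal A ρ' (EqVal-reflˡ A ab)) (reify-EqVal A (EqVal-ren A ρ' ab))))))
  reify-EqVal (ι n)   e          = cong neu e
  reify-EqVal (A ⇒ B) (ext≈ , _) = cong nlam (reify-EqVal B (ext≈ there (reflect-EqVal A (nvar here))))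
  reflect-renNe (ι n)   ρ n' = refl
  reflect-renNe (A ⇒ B) ρ n' = EqVal-⇒ A B (reflect-EqVal (A ⇒ B) (renNe ρ n'))
    (λ ρ' ab → reflect-≡ B (cong₂ napp (≡.sym (renNe-renNe ρ' ρ n')) (reify-EqVal A ab)))
  reify-renVal (ι n)   ρ _            = refl
  reify-renVal (A ⇒ B) ρ (ext≈ , nat) = cong nlam
    (≡.trans (reify-renVal B (ext ρ) (ext≈ there (reflect-EqVal A (nvar here))))
      (≡.trans (reify-EqVal B (nat there (ext ρ) (reflect-EqVal A (nvar here))))
        (reify-EqVal B (ext≈ (there ∘ ρ) (reflect-renNe A (ext ρ) (nvar here))))))

  EqEnv : ∀ {Γ Δ} → Env Γ Δ → Env Γ Δ → Set
  EqEnv {Γ} e e' = ∀ {A} (x : Γ ∋ A) → EqVal A (e x) (e' x)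

  EqEnv-∷ : ∀ {Γ Δ A} {a b : Val Δ A} {e e' : Env Γ Δ} →
            EqVal A a b → EqEnv e e' → EqEnv (a ∷ᵉ e) (b ∷ᵉ e')
  EqEnv-∷ ab h here      = ab
  EqEnv-∷ ab h (there x) = h x

  EqEnv-ren : ∀ {Γ Δ Θ} (ρ : Ren {K} Δ Θ) {e e' : Env Γ Δ} → EqEnv e e' → EqEnv (renEnv ρ e) (renEnv ρ e')
  EqEnv-ren ρ h {A} x = EqVal-ren A ρ (h x)

  EqEnv-sym : ∀ {Γ Δ} {e e' : Env Γ Δ} → EqEnv e e' → EqEnv e' e
  EqEnv-sym h {A} x = EqVal-sym A (h x)

  EqEnv-reflˡ : ∀ {Γ Δ} {e e' : Env Γ Δ} → EqEnv e e' → EqEnv e e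
  EqEnv-reflˡ h {A} x = EqVal-reflˡ A (h x)

  EqEnv-reflʳ : ∀ {Γ Δ} {e e' : Env Γ Δ} → EqEnv e e' → EqEnv e' e'
  EqEnv-reflʳ h {A} x = EqVal-reflʳ A (h x)

  eval-EqVal   : ∀ {Γ Δ A} (t : Tm K Γ A) {e e' : Env Γ Δ} → EqEnv e e' → EqVal A (eval t e) (eval t e')
  eval-renEnv : ∀ {Γ Δ Θ A} (t : Tm K Γ A) {e : Env Γ Δ} → EqEnv e e → (ρ : Ren {K} Δ Θ) →
                EqVal A (renVal A ρ (eval t e)) (eval t (renEnv ρ e))
  eval-EqVal (var x)         h = h x
  eval-EqVal {A = A} (nom n) h = reflect-EqVal A (nnom n)
  eval-EqVal {A = A} (con c) h = reflect-EqVal A (ncon c)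
  eval-EqVal (lam {A} {B} t) h =
    (λ ρ ab → eval-EqVal t (EqEnv-∷ ab (EqEnv-ren ρ h))) ,
    (λ ρ ρ' ab → EqVal-trans B
       (eval-renEnv t (EqEnv-∷ (EqVal-reflˡ A ab) (EqEnv-ren ρ (EqEnv-reflˡ h))) ρ')
       (eval-EqVal t (λ { here      → EqVal-ren A ρ' ab
                        ; (there x) → EqVal-trans _ (renVal-renVal _ ρ ρ' (EqVal-reflˡ _ (h x)))
                                                    (EqVal-ren _ (ρ' ∘ ρ) (h x)) })))
  eval-EqVal (app t u) h = proj₁ (eval-EqVal t h) id (eval-EqVal u h)
  eval-renEnv (var x)         h ρ = EqVal-ren _ ρ (h x)
  eval-renEnv {A = A} (nom n) h ρ = reflect-renNe A ρ (nnom n)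
  eval-renEnv {A = A} (con c) h ρ = reflect-renNe A ρ (ncon c)
  eval-renEnv (lam {A} {B} t) h ρ = EqVal-⇒ A B (eval-EqVal (lam t) (EqEnv-ren ρ h))
    (λ ρ' ab → eval-EqVal t (λ { here      → ab
                               ; (there x) → EqVal-sym _ (renVal-renVal _ ρ ρ' (h x)) }))
  eval-renEnv {A = B} (app t u) h ρ =
    EqVal-trans B (proj₂ (eval-EqVal t h) id ρ (eval-EqVal u h))
                  (proj₁ (eval-renEnv t h ρ) id (eval-renEnv u h ρ))

  eval-ren : ∀ {Γ Γ' Δ A} (t : Tm K Γ A) (ρ : Ren {K} Γ Γ') {e e' : Env Γ' Δ} → EqEnv e e' →
             EqVal A (eval (ren ρ t) e) (eval t (e' ∘ ρ))
  eval-ren (var x)         ρ h = h (ρ x)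
  eval-ren {A = A} (nom n) ρ h = reflect-EqVal A (nnom n)
  eval-ren {A = A} (con c) ρ h = reflect-EqVal A (ncon c)
  eval-ren (app t u)       ρ h = proj₁ (eval-ren t ρ h) id (eval-ren u ρ h)
  eval-ren (lam {A} {B} t) ρ h =
    EqVal-⇒ A B (eval-EqVal (lam t) (EqEnv-reflʳ h ∘ ρ))
      (λ ρ' ab → EqVal-trans B (eval-ren t (ext ρ) (EqEnv-∷ ab (EqEnv-ren ρ' h)))
         (eval-EqVal t (λ { here      → EqVal-reflʳ A ab
                          ; (there x) → EqVal-ren _ ρ' (EqEnv-reflʳ h (ρ x)) })))

  eval-sub : ∀ {Γ Γ' Δ A} (t : Tm K Γ A) (σ : Sub {K} Γ Γ') {e e' : Env Γ' Δ} → EqEnv e e' →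
             EqVal A (eval (sub σ t) e) (eval t (λ x → eval (σ x) e'))
  eval-sub (var x)         σ h = eval-EqVal (σ x) h
  eval-sub {A = A} (nom n) σ h = reflect-EqVal A (nnom n)
  eval-sub {A = A} (con c) σ h = reflect-EqVal A (ncon c)
  eval-sub (app t u)       σ h = proj₁ (eval-sub t σ h) id (eval-sub u σ h)
  eval-sub (lam {A} {B} t) σ h =
    EqVal-⇒ A B (eval-EqVal (lam t) (λ x → eval-EqVal (σ x) (EqEnv-reflʳ h)))
      (λ ρ' ab → EqVal-trans B (eval-sub t (exts σ) (EqEnv-∷ ab (EqEnv-ren ρ' h)))
         (eval-EqVal t (λ { here      → EqVal-reflʳ A ab
                          ; (there x) → EqVal-trans _
                              (eval-ren (σ x) there (EqEnv-∷ (EqVal-reflʳ A ab) (EqEnv-ren ρ' (EqEnv-reflʳ h))))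
                              (EqVal-sym _ (eval-renEnv (σ x) (EqEnv-reflʳ h) ρ')) })))

  eval-≡βη : ∀ {Γ Δ A} {t t' : Tm K Γ A} → t ≡βη t' → {e e' : Env Γ Δ} → EqEnv e e' →
             EqVal A (eval t e) (eval t' e')
  eval-≡βη (β t u) h =
    EqVal-trans _ (eval-EqVal t (λ { here      → eval-EqVal u h
                                   ; (there x) → EqVal-trans _ (renVal-id _ (EqEnv-reflˡ h x)) (h x) }))
      (EqVal-sym _ (eval-sub t (single u) (EqEnv-reflʳ h)))
  eval-≡βη (η {A} {B} t) h =
    EqVal-⇒ A B (eval-EqVal t (EqEnv-reflʳ h))
      (λ ρ ab → proj₁ (EqVal-trans (A ⇒ B)
                        (eval-ren t there (EqEnv-∷ (EqVal-reflˡ A ab) (EqEnv-ren ρ (EqEnv-reflˡ h))))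
                        (EqVal-trans (A ⇒ B) (EqVal-sym (A ⇒ B) (eval-renEnv t (EqEnv-reflˡ h) ρ))
                           (EqVal-ren (A ⇒ B) ρ (eval-EqVal t h)))) id ab)
  eval-≡βη (refl {t = t}) h  = eval-EqVal t h
  eval-≡βη (sym p) h         = EqVal-sym _ (eval-≡βη p (EqEnv-sym h))
  eval-≡βη (trans p q) h     = EqVal-trans _ (eval-≡βη p h) (eval-≡βη q (EqEnv-reflʳ h))
  eval-≡βη (lam-cong {A} {B} {t' = t'} p) h =
    EqVal-⇒ A B (eval-EqVal (lam t') (EqEnv-reflʳ h)) (λ ρ ab → eval-≡βη p (EqEnv-∷ ab (EqEnv-ren ρ h)))
  eval-≡βη (app-cong p q) h  = proj₁ (eval-≡βη p h) id (eval-≡βη q h)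

  nf-≡βη : ∀ {Γ A} {t t' : Tm K Γ A} → t ≡βη t' → nf t ≡ nf t'
  nf-≡βη {A = A} p = reify-EqVal A (eval-≡βη p λ {B} x → reflect-EqVal B (nvar x))


  Denotes : ∀ {Γ} A → Tm K Γ A → Val Γ A → Set
  Denotes (ι n)     t v = t ≡βη ⌜ v ⌝ⁿᵉ
  Denotes {Γ} (A ⇒ B) t f =
    ∀ {Δ} (ρ : Ren {K} Γ Δ) {u a} → Denotes A u a → Denotes B (app (ren ρ t) u) (f ρ a)

  Denotes-≡βη : ∀ {Γ} A {t t' : Tm K Γ A} {v} → t ≡βη t' → Denotes A t' v → Denotes A t v
  Denotes-≡βη (ι n)   p d      = trans p d
  Denotes-≡βη (A ⇒ B) p d ρ du = Denotes-≡βη B (app-cong (ren-≡βη ρ p) refl) (d ρ du)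

  Denotes-ren : ∀ {Γ Δ} A (ρ : Ren {K} Γ Δ) {t v} → Denotes A t v → Denotes A (ren ρ t) (renVal A ρ v)
  Denotes-ren (ι n)   ρ {v = v} d = trans (ren-≡βη ρ d) (≡⇒≡βη (≡.sym (⌜renNe⌝ ρ v)))
  Denotes-ren (A ⇒ B) ρ {t} d ρ' {u} du =
    subst (λ s → Denotes B (app s u) _) (≡.sym (ren-ren ρ' ρ t)) (d (ρ' ∘ ρ) du)

  reflect-Denotes : ∀ {Γ} A {t : Tm K Γ A} (n : Ne K Γ A) → t ≡βη ⌜ n ⌝ⁿᵉ → Denotes A t (reflect A n)
  reify-Denotes   : ∀ {Γ} A {t : Tm K Γ A} {v} → Denotes A t v → t ≡βη ⌜ reify A v ⌝
  reflect-Denotes (ι n)   n' p = p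
  reflect-Denotes (A ⇒ B) n' p ρ du =
    reflect-Denotes B _ (app-cong (trans (ren-≡βη ρ p) (≡⇒≡βη (≡.sym (⌜renNe⌝ ρ n')))) (reify-Denotes A du))
  reify-Denotes (ι n)   d = d
  reify-Denotes (A ⇒ B) {t} d =
    trans (sym (η t)) (lam-cong (reify-Denotes B (d there (reflect-Denotes A (nvar here) refl))))

  infixr 5 _∷ˢ_
  _∷ˢ_ : ∀ {Γ Δ A} → Tm K Δ A → Sub {K} Γ Δ → Sub {K} (A ∷ Γ) Δ
  (u ∷ˢ σ) here      = u
  (u ∷ˢ σ) (there x) = σ x

  sub-Denotes-eval : ∀ {Γ Δ A} (t : Tm K Γ A) (σ : Sub {K} Γ Δ) (e : Env Γ Δ) →
                     (∀ {B} (x : Γ ∋ B) → Denotes B (σ x) (e x)) → Denotes A (sub σ t) (eval t e)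
  sub-Denotes-eval (var x)         σ e h = h x
  sub-Denotes-eval {A = A} (nom n) σ e h = reflect-Denotes A (nnom n) refl
  sub-Denotes-eval {A = A} (con c) σ e h = reflect-Denotes A (ncon c) refl
  sub-Denotes-eval {A = B} (app t u) σ e h =
    subst (λ s → Denotes B (app s (sub σ u)) _) (ren-id (sub σ t))
          (sub-Denotes-eval t σ e h id (sub-Denotes-eval u σ e h))
  sub-Denotes-eval (lam {A} {B} t) σ e h ρ {u} {a} du =
    Denotes-≡βη B (trans (β _ _) (≡⇒≡βη β-reduct))
      (sub-Denotes-eval t (u ∷ˢ ren ρ ∘ σ) (a ∷ᵉ renEnv ρ e)
        (λ { here → du ; (there x) → Denotes-ren _ ρ (h x) }))
    where
    β-reduct : sub (single u) (ren (ext ρ) (sub (exts σ) t)) ≡ sub (u ∷ˢ ren ρ ∘ σ) t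
    β-reduct = ≡.trans (sub-ren (single u) (ext ρ) (sub (exts σ) t))
      (≡.trans (sub-sub _ (exts σ) t)
        (sub-cong (λ { here → refl
                     ; (there x) → ≡.trans (sub-ren _ there (σ x)) (sub-var∘ ρ (σ x)) }) t))

  nf-sound : ∀ {Γ A} (t : Tm K Γ A) → t ≡βη ⌜ nf t ⌝
  nf-sound {A = A} t = reify-Denotes A (subst (λ s → Denotes A s (eval t idEnv)) (sub-var t)
    (sub-Denotes-eval t var idEnv (λ {B} x → reflect-Denotes B (nvar x) refl)))


  module NamesWithin (P : Ty → ℕ → Set) where

    Within : ∀ {Γ} A → Val Γ A → Set
    Within (ι n)       v = ∀ {B m} → Occurs B m ⌜ v ⌝ⁿᵉ → P B m
    Within {Γ} (A ⇒ B) f = ∀ {Δ} (ρ : Ren {K} Γ Δ) {a} → Within A a → Within B (f ρ a)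

    Within-ren : ∀ {Γ Δ} A (ρ : Ren {K} Γ Δ) {v} → Within A v → Within A (renVal A ρ v)
    Within-ren (ι n)   ρ {v} w o = w (Occurs-ren⁻ ρ ⌜ v ⌝ⁿᵉ (subst (Occurs _ _) (⌜renNe⌝ ρ v) o))
    Within-ren (A ⇒ B) ρ w ρ'    = w (ρ' ∘ ρ)

    reflect-Within : ∀ {Γ} A (n : Ne K Γ A) → (∀ {B m} → Occurs B m ⌜ n ⌝ⁿᵉ → P B m) →
                     Within A (reflect A n)
    reify-Within   : ∀ {Γ} A {v : Val Γ A} → Within A v → ∀ {B m} → Occurs B m ⌜ reify A v ⌝ → P B m
    reflect-Within (ι n)   n' w = w
    reflect-Within (A ⇒ B) n' w ρ {a} wa = reflect-Within B _ napp-within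
      where
      napp-within : ∀ {C m} → Occurs C m (app ⌜ renNe ρ n' ⌝ⁿᵉ ⌜ reify A a ⌝) → P C m
      napp-within (occ-appl o) = w (Occurs-ren⁻ ρ ⌜ n' ⌝ⁿᵉ (subst (Occurs _ _) (⌜renNe⌝ ρ n') o))
      napp-within (occ-appr o) = reify-Within A wa o
    reify-Within (ι n)   w o           = w o
    reify-Within (A ⇒ B) w (occ-lam o) = reify-Within B (w there (reflect-Within A (nvar here) λ ())) o

    eval-Within : ∀ {Γ Δ A} (t : Tm K Γ A) {e : Env Γ Δ} → (∀ {B m} → Occurs B m t → P B m) →
                  (∀ {B} (x : Γ ∋ B) → Within B (e x)) → Within A (eval t e)
    eval-Within (var x)         w h = h x
    eval-Within {A = A} (nom n) w h = reflect-Within A (nnom n) λ { occ-nom → w occ-nom }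
    eval-Within {A = A} (con c) w h = reflect-Within A (ncon c) λ ()
    eval-Within (lam t)   w h ρ wa  =
      eval-Within t (w ∘ occ-lam) (λ { here → wa ; (there x) → Within-ren _ ρ (h x) })
    eval-Within (app t u) w h       = eval-Within t (w ∘ occ-appl) h id (eval-Within u (w ∘ occ-appr) h)

  Occurs-nf⁻ : ∀ {Γ A B n} (t : Tm K Γ A) → Occurs B n ⌜ nf t ⌝ → Occurs B n t
  Occurs-nf⁻ {A = A} t = reify-Within A (eval-Within t id λ {B} x → reflect-Within B (nvar x) λ ())
    where open NamesWithin (λ B n → Occurs B n t)

  -- Supports and βη

  Occurs-nf⇒Supp : ∀ {Γ A B n} (t : Tm K Γ A) → Occurs B n ⌜ nf t ⌝ → Supp t B n
  Occurs-nf⇒Supp {B = B} {n} t o w t≡w = Occurs-nf⁻ w (subst (λ v → Occurs B n ⌜ v ⌝) (nf-≡βη t≡w) o)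

  Supp-≡βη : ∀ {Γ A B n} {t u : Tm K Γ A} → t ≡βη u → Supp u B n → Supp t B n
  Supp-≡βη t≡u s w t≡w = s w (trans (sym t≡u) t≡w)

  Supp-· : ∀ {Γ A B n} (π : Perm) {t : Tm K Γ A} → Supp t B n → Supp (π · t) B (fun π B n)
  Supp-· π {t} s w πt≡w = Occurs-·⁻ (π ⁻¹ₚ) w (s (π ⁻¹ₚ · w) t≡π⁻¹w)
    where
    t≡π⁻¹w : t ≡βη π ⁻¹ₚ · w
    t≡π⁻¹w = trans (≡⇒≡βη (≡.sym (⁻¹ₚ-· π t))) (·-≡βη (π ⁻¹ₚ) πt≡w)

  rangeNames : ∀ {Γ Δ} → Sub {K} Γ Δ → List Name
  rangeNames {[]}    θ = []
  rangeNames {A ∷ Γ} θ = names ⌜ nf (θ here) ⌝ ++ rangeNames (θ ∘ there)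

  ∈rangeNames⇒SuppSub : ∀ {Γ Δ B n} (θ : Sub {K} Γ Δ) → (B , n) ∈ rangeNames θ → SuppSub θ B n
  ∈rangeNames⇒SuppSub {A ∷ Γ} θ m with ∈-++⁻ (names ⌜ nf (θ here) ⌝) m
  ... | inj₁ m' = A , here , Occurs-nf⇒Supp (θ here) (∈names⇒Occurs _ m')
  ... | inj₂ m' with ∈rangeNames⇒SuppSub (θ ∘ there) m'
  ...   | C , x , s = C , there x , s

  Occurs-nf⇒∈rangeNames : ∀ {Γ Δ B C n} (θ : Sub {K} Γ Δ) (x : Γ ∋ C) →
                          Occurs B n ⌜ nf (θ x) ⌝ → (B , n) ∈ rangeNames θ
  Occurs-nf⇒∈rangeNames θ here      o = ∈-++⁺ˡ (Occurs⇒∈names _ o)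
  Occurs-nf⇒∈rangeNames θ (there x) o =
    ∈-++⁺ʳ (names ⌜ nf (θ here) ⌝) (Occurs-nf⇒∈rangeNames (θ ∘ there) x o)


  ·-cong-nf : ∀ {Γ A} {π ρ : Perm} (t : Tm K Γ A) →
              (∀ {B n} → Occurs B n ⌜ nf t ⌝ → fun π B n ≡ fun ρ B n) → π · t ≡βη ρ · t
  ·-cong-nf {π = π} {ρ} t h =
    trans (·-≡βη π (nf-sound t)) (trans (≡⇒≡βη (·-cong ⌜ nf t ⌝ h)) (·-≡βη ρ (sym (nf-sound t))))

  ·-fixes-nf : ∀ {Γ A} {π : Perm} (t : Tm K Γ A) →
               (∀ {B n} → Occurs B n ⌜ nf t ⌝ → fun π B n ≡ n) → π · t ≡βη t
  ·-fixes-nf {π = π} t h =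
    trans (·-≡βη π (nf-sound t)) (trans (≡⇒≡βη (·-fixes ⌜ nf t ⌝ h)) (sym (nf-sound t)))

  ·-sub-fixing : ∀ {Γ Δ A} (π : Perm) (θ : Sub {K} Γ Δ) (t : Tm K Γ A) →
                 (∀ {B} (x : Γ ∋ B) → π · θ x ≡βη θ x) → π · sub θ t ≡βη sub θ (π · t)
  ·-sub-fixing π θ t h = trans (≡⇒≡βη (·-sub π θ t)) (sub-cong-≡βη h (π · t))

≡βη-setoid : (K : Ty → Set) (Γ : Ctx) (A : Ty) → Setoid _ _
≡βη-setoid K Γ A = record
  { Carrier       = Tm K Γ A
  ; _≈_           = _≡βη_
  ; isEquivalence = record { refl = refl ; sym = sym ; trans = trans }
  }

lemma3p3 : (K : Ty → Set) {Γ Δ : Ctx} {A : Ty}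
           (t t' : Tm K Γ A) (θ : Sub {K} Γ Δ) →
           t ≈ t' →
           (π₁ π₂ : Perm) → Admissible π₁ t θ → Admissible π₂ t' θ →
           nomSub t θ π₁ ≈ nomSub t' θ π₂
lemma3p3 K {Γ} {Δ} {A} t t' θ (π , t≡πt') π₁ π₂ adm₁ adm₂
  with ∃-perm-carrying (π₁ ∘ₚ π) π₂ (names ⌜ nf t' ⌝) (rangeNames θ) π₁∘π-avoids-θ π₂-avoids-θ
  where
  names-nf⊆Supp : ∀ {B k} → (B , k) ∈ names ⌜ nf t' ⌝ → Supp t' B k
  names-nf⊆Supp = Occurs-nf⇒Supp t' ∘ ∈names⇒Occurs _

  π₁∘π-avoids-θ : ∀ {B k} → (B , k) ∈ names ⌜ nf t' ⌝ → (B , fun (π₁ ∘ₚ π) B k) ∉ rangeNames θ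
  π₁∘π-avoids-θ k∈nf = adm₁ _ _ (Supp-≡βη t≡πt' (Supp-· π (names-nf⊆Supp k∈nf))) ∘ ∈rangeNames⇒SuppSub θ

  π₂-avoids-θ : ∀ {B k} → (B , k) ∈ names ⌜ nf t' ⌝ → (B , fun π₂ B k) ∉ rangeNames θ
  π₂-avoids-θ k∈nf = adm₂ _ _ (names-nf⊆Supp k∈nf) ∘ ∈rangeNames⇒SuppSub θ
... | σ , carries , fixes = σ , (begin
    sub θ (π₁ · t)          ≈⟨ sub-≡βη θ (·-≡βη π₁ t≡πt') ⟩
    sub θ (π₁ · π · t')     ≡⟨ cong (sub θ) (≡.sym (·-∘ₚ π₁ π t')) ⟩
    sub θ ((π₁ ∘ₚ π) · t')  ≈⟨ sub-≡βη θ (·-cong-nf t' (≡.sym ∘ carries ∘ Occurs⇒∈names _)) ⟩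
    sub θ ((σ ∘ₚ π₂) · t')  ≡⟨ cong (sub θ) (·-∘ₚ σ π₂ t') ⟩
    sub θ (σ · π₂ · t')     ≈⟨ sym (·-sub-fixing σ θ (π₂ · t') σ-fixes-θ) ⟩
    σ · sub θ (π₂ · t')     ∎)
  where
  open Relation.Binary.Reasoning.Setoid (≡βη-setoid K Δ A)

  σ-fixes-θ : ∀ {B} (x : Γ ∋ B) → σ · θ x ≡βη θ x
  σ-fixes-θ x = ·-fixes-nf (θ x) (fixes ∘ Occurs-nf⇒∈rangeNames θ x)
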